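{- The exponential generating function $R_0(z)=\sum_{n\ge0} r_{0,n}\frac{z^n}{n!}$ of relaxed trees of right height $0$ is $R_0(z)=\frac{1}{1-z}$, and $r_{0,n}=n!$ for all $n\ge0$.
   Context: A relaxed tree of size $n$: take a full binary tree $T$ (each node has $0$ or $2$ ordered children) with $n$ internal nodes, traverse it in post-order (left, right, node); keep the first leaf as the sink and replace every other leaf $\lambda$ by a pointer to a node (internal node or the sink) visited before $\lambda$; relaxed trees are equal iff same $T$ and same pointer targets. The spine is the binary tree of internal nodes of $T$ with the edges of $T$ between them; the right height is the maximal number of right edges on a spine path from the root to a spine node. $r_{0,n}$ is the number of relaxed trees of size $n$ with right height $0$. -}

module Defs where

open import Data.Nat using (ℕ; zero; suc; _+_; _⊔_)
open import Data.Fin using (Fin)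
open import Data.List using (List; []; _∷_; _++_; drop)
open import Data.Product using (Σ; _×_)
open import Relation.Binary.PropositionalEquality using (_≡_)

data FBT : Set where
  leaf : FBT
  node : FBT → FBT → FBT

internal : FBT → ℕ
internal leaf       = 0
internal (node l r) = suc (internal l + internal r)

-- Post-order traversal (left, right, node): for every leaf, in post-order,
-- the number of admissible pointer targets visited before it, namely
-- 1 (the sink) + the number of internal nodes visited before it.
-- The argument c is the number of internal nodes visited before the subtree.
leafTargets : ℕ → FBT → List ℕ
leafTargets c leaf       = suc c ∷ []
leafTargets c (node l r) = leafTargets c l ++ leafTargets (c + internal l) r

-- The first leaf is the sink; every other leaf carries a pointer.
pointerBounds : FBT → List ℕ
pointerBounds t = drop 1 (leafTargets 0 t)

-- A choice of pointer target for each pointer leaf: a leaf with b admissible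
-- targets gets an element of Fin b (index 0 = the sink, index i ≥ 1 = the
-- i-th internal node in post-order).
data Choices : List ℕ → Set where
  []  : Choices []
  _∷_ : ∀ {b bs} → Fin b → Choices bs → Choices (b ∷ bs)

-- Right height: maximal number of right edges on a spine path from the root
-- to a spine node (spine = internal nodes). Empty spine: 0.
rightHeight : FBT → ℕ
rightHeight leaf                  = 0
rightHeight (node l leaf)         = rightHeight l
rightHeight (node l r@(node _ _)) = rightHeight l ⊔ suc (rightHeight r)

RelaxedTree : ℕ → Set
RelaxedTree n = Σ FBT (λ t → (internal t ≡ n) × Choices (pointerBounds t))

RelaxedTree0 : ℕ → Set
RelaxedTree0 n =
  Σ FBT (λ t → (internal t ≡ n) × (rightHeight t ≡ 0) × Choices (pointerBounds t))

-- A spine of right height 0 has no right edges, so it is a left path: the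
-- only relaxed-tree shape of size n with right height 0 is the left comb.
-- Its leaves, in post-order, are the sink followed by leaves with 1, 2, …, n
-- admissible targets, so the pointers can be chosen in 1 · 2 ⋯ n = n! ways.
module Submission where

open import Defs
open import Axiom.UniquenessOfIdentityProofs.WithK using (uip)
open import Data.Nat using (ℕ; zero; suc; _*_; _!)
open import Data.Nat.ListAction using (product)
open import Data.Nat.ListAction.Properties using (product-++)
open import Data.Nat.Properties using (≡-irrelevant; +-identityʳ; *-identityʳ; *-comm)
open import Data.Fin using (Fin)
open import Data.Fin.Properties using (*↔×)
open import Data.List using ([]; _∷_; _++_; drop; applyUpTo)
open import Data.List.Properties using (applyUpTo-∷ʳ)
open import Data.Product using (_×_; _,_)
open import Data.Product.Function.NonDependent.Propositional using (_×-↔_)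
open import Function using (_∘_)
open import Function.Bundles using (_↔_; mk↔ₛ′)
open import Function.Properties.Inverse using (↔-refl; ↔-sym; ↔-trans)
open import Relation.Binary.PropositionalEquality
  using (_≡_; refl; sym; trans; cong; cong₂; subst; module ≡-Reasoning)

leftComb : ℕ → FBT
leftComb zero    = leaf
leftComb (suc n) = node (leftComb n) leaf

internal-leftComb : ∀ n → internal (leftComb n) ≡ n
internal-leftComb zero    = refl
internal-leftComb (suc n) = cong suc (trans (+-identityʳ _) (internal-leftComb n))

rightHeight-leftComb : ∀ n → rightHeight (leftComb n) ≡ 0
rightHeight-leftComb zero    = refl
rightHeight-leftComb (suc n) = rightHeight-leftComb n

rightHeight≡0⇒leftComb : ∀ t → rightHeight t ≡ 0 → t ≡ leftComb (internal t)
rightHeight≡0⇒leftComb leaf                h = refl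
rightHeight≡0⇒leftComb (node l leaf)       h =
  cong (λ u → node u leaf)
       (trans (rightHeight≡0⇒leftComb l h) (cong leftComb (sym (+-identityʳ _))))
rightHeight≡0⇒leftComb (node l (node _ _)) h with rightHeight l | h
... | zero  | ()
... | suc _ | ()

leafTargets-leftComb : ∀ n → leafTargets 0 (leftComb n) ≡ 1 ∷ applyUpTo suc n
leafTargets-leftComb zero    = refl
leafTargets-leftComb (suc n) = begin
  leafTargets 0 (leftComb n) ++ suc (internal (leftComb n)) ∷ []
    ≡⟨ cong₂ (λ xs k → xs ++ suc k ∷ []) (leafTargets-leftComb n) (internal-leftComb n) ⟩
  1 ∷ applyUpTo suc n ++ suc n ∷ []
    ≡⟨ cong (1 ∷_) (applyUpTo-∷ʳ suc n) ⟩
  1 ∷ applyUpTo suc (suc n) ∎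
  where open ≡-Reasoning

product-applyUpTo-suc : ∀ n → product (applyUpTo suc n) ≡ n !
product-applyUpTo-suc zero    = refl
product-applyUpTo-suc (suc n) = begin
  product (applyUpTo suc (suc n))            ≡⟨ cong product (sym (applyUpTo-∷ʳ suc n)) ⟩
  product (applyUpTo suc n ++ suc n ∷ [])    ≡⟨ product-++ (applyUpTo suc n) (suc n ∷ []) ⟩
  product (applyUpTo suc n) * (suc n * 1)    ≡⟨ cong₂ _*_ (product-applyUpTo-suc n) (*-identityʳ (suc n)) ⟩
  n ! * suc n                                ≡⟨ *-comm (n !) (suc n) ⟩
  suc n !                                    ∎
  where open ≡-Reasoning

product-pointerBounds-leftComb : ∀ n → product (pointerBounds (leftComb n)) ≡ n !
product-pointerBounds-leftComb n =
  trans (cong (product ∘ drop 1) (leafTargets-leftComb n)) (product-applyUpTo-suc n)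

Choices-∷↔ : ∀ {b bs} → Choices (b ∷ bs) ↔ (Fin b × Choices bs)
Choices-∷↔ = mk↔ₛ′ (λ { (i ∷ is) → i , is }) (λ { (i , is) → i ∷ is })
                   (λ _ → refl) (λ { (_ ∷ _) → refl })

Choices↔Fin-product : ∀ bs → Choices bs ↔ Fin (product bs)
Choices↔Fin-product []       =
  mk↔ₛ′ (λ _ → Fin.zero) (λ _ → []) (λ { Fin.zero → refl ; (Fin.suc ()) }) (λ { [] → refl })
Choices↔Fin-product (b ∷ bs) =
  ↔-trans Choices-∷↔ (↔-trans (↔-refl ×-↔ Choices↔Fin-product bs) (↔-sym (*↔× {b})))

RelaxedTree0↔Choices-leftComb : ∀ n → RelaxedTree0 n ↔ Choices (pointerBounds (leftComb n))
RelaxedTree0↔Choices-leftComb n = mk↔ₛ′ to from to∘from from∘to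
  where
  P : FBT → Set
  P = Choices ∘ pointerBounds

  isLeftComb : ∀ t → internal t ≡ n → rightHeight t ≡ 0 → t ≡ leftComb n
  isLeftComb t p h = trans (rightHeight≡0⇒leftComb t h) (cong leftComb p)

  to : RelaxedTree0 n → P (leftComb n)
  to (t , p , h , c) = subst P (isLeftComb t p h) c

  from : P (leftComb n) → RelaxedTree0 n
  from c = leftComb n , internal-leftComb n , rightHeight-leftComb n , c

  to∘from : ∀ c → to (from c) ≡ c
  to∘from c = cong (λ e → subst P e c) (uip (isLeftComb (leftComb n) _ _) refl)

  from-subst : ∀ {t} (e : t ≡ leftComb n) p h c → from (subst P e c) ≡ (t , p , h , c)
  from-subst refl p h c =
    cong₂ (λ p h → leftComb n , p , h , c) (≡-irrelevant _ p) (≡-irrelevant _ h)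

  from∘to : ∀ r → from (to r) ≡ r
  from∘to (t , p , h , c) = from-subst (isLeftComb t p h) p h c

mainTheorem7 : (n : ℕ) → RelaxedTree0 n ↔ Fin (n !)
mainTheorem7 n =
  subst (λ k → RelaxedTree0 n ↔ Fin k) (product-pointerBounds-leftComb n)
        (↔-trans (RelaxedTree0↔Choices-leftComb n) (Choices↔Fin-product _))
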